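{- Every reflection complex $M=(V,E,B)$ is $2$-reducible, i.e. $V\in E$ and every $T\in E$ with $|T|>2$ can be written as $T=A_1\cup A_2$ with $A_1,A_2\in E$, $\max(|A_1|,|A_2|)<|T|$ and $(A_1,A_2)\in B$.
   Context: A $b$-hypergraph is a triple $M=(V,E,B)$ with $V$ a finite set, $E\subseteq 2^V$ and $B\subseteq 2^V\times 2^V$ a symmetric relation. For $W\subseteq V$, the sub-$b$-hypergraph on $W$ is $(W,\{L\in E:L\subseteq W\},B\cap(2^W\times 2^W))$. Given $b$-hypergraphs $M_1=(V_1,E_1,B_1)$, $M_2=(V_2,E_2,B_2)$ and injective maps $\phi_i:F\to V_i$, let $V$ be the disjoint union of $V_1,V_2$ with $\phi_1(x)$ identified with $\phi_2(x)$ for all $x\in F$, with natural injections $\tau_i:V_i\to V$. $M_1\cup^*_{\phi_1,\phi_2}M_2$ is the $b$-hypergraph on $V$ whose edges are the sets $\tau_1(K)$ ($K\in E_1$), $\tau_2(K)$ ($K\in E_2$), and $\tau_1(K_1)\cup\tau_2(K_2)$ for all $K_1\in E_1,K_2\in E_2$ with $\phi_1(F)\subseteq K_1$, $\phi_2(F)\subseteq K_2$; and whose relation consists of the $\tau_1$-images of pairs in $B_1$, the $\tau_2$-images of pairs in $B_2$, and the pairs $(\tau_1(K_1),\tau_2(K_2))$ (with their reverses) for all such $K_1,K_2$. For $L\in E$ and $X\subseteq L$, $r_{L,X}(M):=M\cup^*_{\phi_1,\phi_2}N$ where $N$ is the sub-$b$-hypergraph on $L$ and $\phi_1:X\to V$,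 $\phi_2:X\to L$ are the inclusions. A reflection complex is a $b$-hypergraph obtained from the trivial reflection complex $(\{1,2\},\{\{1,2\}\},\emptyset)$ by a finite sequence of operations $M\mapsto r_{L,X}(M)$, with $L$ an edge of the current $b$-hypergraph and $X\subseteq L$. -}

module Defs where

open import Level using (0ℓ)
open import Data.Nat using (ℕ; zero; suc; _<_; _⊔_)
open import Data.Fin using (Fin)
import Data.Fin as F
open import Data.Fin.Subset using (Subset; inside; outside; ⊤; ⊥; ⁅_⁆; _∪_; _⊆_; ∣_∣)
open import Data.Vec using ([]; _∷_)
open import Data.Product using (Σ; ∃; ∃-syntax; _×_; _,_)
open import Data.Sum using (_⊎_)
open import Data.Empty renaming (⊥ to Empty)
open import Function using (_∘_)
open import Function.Definitions using (Injective)
open import Relation.Binary.PropositionalEquality using (_≡_)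

img : ∀ {a b} → (Fin a → Fin b) → Subset a → Subset b
img {zero}  f []             = ⊥
img {suc a} f (inside  ∷ K) = ⁅ f F.zero ⁆ ∪ img (f ∘ F.suc) K
img {suc a} f (outside ∷ K) = img (f ∘ F.suc) K

record BHyp : Set₁ where
  constructor bhyp
  field
    n : ℕ
    E : Subset n → Set
    B : Subset n → Subset n → Set
open BHyp public

-- Data realizing the pushout vertex set V of M₁ ∪*_{φ₁,φ₂} M₂ as Fin n:
-- injections τᵢ, jointly surjective, identifying exactly φ₁(x) with φ₂(x).
record GlueData {n₁ n₂ k : ℕ} (φ₁ : Fin k → Fin n₁) (φ₂ : Fin k → Fin n₂) : Set where
  field
    n      : ℕ
    τ₁     : Fin n₁ → Fin n
    τ₂     : Fin n₂ → Fin n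
    τ₁-inj : Injective _≡_ _≡_ τ₁
    τ₂-inj : Injective _≡_ _≡_ τ₂
    agree  : ∀ x → τ₁ (φ₁ x) ≡ τ₂ (φ₂ x)
    only   : ∀ a b → τ₁ a ≡ τ₂ b → ∃[ x ] (φ₁ x ≡ a × φ₂ x ≡ b)
    cover  : ∀ v → (∃[ a ] τ₁ a ≡ v) ⊎ (∃[ b ] τ₂ b ≡ v)

glue : (M₁ M₂ : BHyp) {k : ℕ} {φ₁ : Fin k → Fin (n M₁)} {φ₂ : Fin k → Fin (n M₂)}
       → GlueData φ₁ φ₂ → BHyp
glue M₁ M₂ {φ₁ = φ₁} {φ₂} g = bhyp N Eg Bg
  where
    open GlueData g renaming (n to N)
    Joint : Subset N → Subset N → Set
    Joint P Q = Σ (Subset (n M₁)) λ K₁ → Σ (Subset (n M₂)) λ K₂ →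
      E M₁ K₁ × E M₂ K₂ × img φ₁ ⊤ ⊆ K₁ × img φ₂ ⊤ ⊆ K₂ ×
      P ≡ img τ₁ K₁ × Q ≡ img τ₂ K₂
    Eg : Subset N → Set
    Eg T = (∃[ K ] (E M₁ K × T ≡ img τ₁ K))
         ⊎ (∃[ K ] (E M₂ K × T ≡ img τ₂ K))
         ⊎ (Σ (Subset (n M₁)) λ K₁ → Σ (Subset (n M₂)) λ K₂ →
              E M₁ K₁ × E M₂ K₂ × img φ₁ ⊤ ⊆ K₁ × img φ₂ ⊤ ⊆ K₂ ×
              T ≡ img τ₁ K₁ ∪ img τ₂ K₂)
    Bg : Subset N → Subset N → Set
    Bg P Q = (Σ (Subset (n M₁)) λ P₁ → Σ (Subset (n M₁)) λ Q₁ →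
                B M₁ P₁ Q₁ × P ≡ img τ₁ P₁ × Q ≡ img τ₁ Q₁)
           ⊎ (Σ (Subset (n M₂)) λ P₂ → Σ (Subset (n M₂)) λ Q₂ →
                B M₂ P₂ Q₂ × P ≡ img τ₂ P₂ × Q ≡ img τ₂ Q₂)
           ⊎ Joint P Q
           ⊎ Joint Q P

-- The sub-b-hypergraph on W, realized on Fin m via an injection ι with image W.
sub : (M : BHyp) {m : ℕ} (ι : Fin m → Fin (n M)) → BHyp
sub M {m} ι = bhyp m (λ K → E M (img ι K)) (λ P Q → B M (img ι P) (img ι Q))

-- Data for the operation r_{L,X}(M): L realized as Fin m via ι, X realized as
-- Fin k via φ₁ : X → V (inclusion) and φ₂ : X → L (inclusion), and a
-- realization of the glued vertex set.
record RData (M : BHyp) (L X : Subset (n M)) : Set where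
  field
    m      : ℕ
    ι      : Fin m → Fin (n M)
    ι-inj  : Injective _≡_ _≡_ ι
    ι-img  : img ι ⊤ ≡ L
    k      : ℕ
    φ₁     : Fin k → Fin (n M)
    φ₁-inj : Injective _≡_ _≡_ φ₁
    φ₁-img : img φ₁ ⊤ ≡ X
    φ₂     : Fin k → Fin m
    φ-comm : ∀ x → ι (φ₂ x) ≡ φ₁ x
    gd     : GlueData φ₁ φ₂

reflect : (M : BHyp) {L X : Subset (n M)} → RData M L X → BHyp
reflect M d = glue M (sub M ι) gd
  where open RData d

trivialRC : BHyp
trivialRC = bhyp 2 (λ T → T ≡ ⊤) (λ _ _ → Empty)

data ReflectionComplex : BHyp → Set₁ where
  triv : ReflectionComplex trivialRC
  step : ∀ {M} → ReflectionComplex M →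
         (L X : Subset (n M)) → E M L → X ⊆ L →
         (d : RData M L X) → ReflectionComplex (reflect M d)

TwoReducible : BHyp → Set
TwoReducible M =
  E M ⊤ ×
  (∀ T → E M T → 2 < ∣ T ∣ →
     Σ (Subset (n M)) λ A₁ → Σ (Subset (n M)) λ A₂ →
       E M A₁ × E M A₂ × T ≡ A₁ ∪ A₂ ×
       (∣ A₁ ∣ ⊔ ∣ A₂ ∣) < ∣ T ∣ × B M A₁ A₂)

-- Call an edge T of a b-hypergraph reducible when, as soon as |T| > 2, it is
-- the union of two strictly smaller edges related by B.  The proof is an
-- induction along the construction of the reflection complex, and the
-- induction step is a statement about gluing arbitrary b-hypergraphs:
--
--   * images of subsets under injections preserve unions and cardinalities,
--     so an embedding of b-hypergraphs carries reducible edges to reducible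
--     edges, and a sub-b-hypergraph inherits reducibility of its edges;
--   * in M₁ ∪* M₂ the old edges are images under the embeddings τ₁, τ₂; a
--     joint edge τ₁(K₁) ∪ τ₂(K₂) either collapses onto one of its halves
--     (when K₁ or K₂ lies inside the glued part φ(F)), or both halves have
--     private vertices, and then the halves themselves are a B-related
--     splitting into strictly smaller edges;
--   * the whole vertex set of M₁ ∪* M₂ is the joint edge of the two vertex
--     sets.
--
-- Hence gluing preserves 2-reducibility, and r_{L,X}(M) = M ∪* (M restricted
-- to L) is 2-reducible when M is; the trivial complex is 2-reducible since
-- its only edge has two vertices.
module Submission where

open import Defs
open import Data.Nat using (zero; suc; _<_; _⊔_; s≤s)
open import Data.Nat.Properties using (⊔-lub)
open import Data.Fin using (Fin)
import Data.Fin as F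
open import Data.Fin.Properties using (suc-injective; any?)
open import Data.Fin.Subset
open import Data.Fin.Subset.Properties
open import Data.Vec using ([]; _∷_; tabulate; lookup)
open import Data.Vec.Properties using ([]=⇒lookup; lookup⇒[]=; lookup∘tabulate)
open import Data.Vec.Base using (here; there)
open import Data.Product using (Σ; ∃-syntax; _×_; _,_)
open import Data.Sum using (_⊎_; inj₁; inj₂; [_,_])
open import Data.Empty using (⊥-elim)
open import Function using (_∘_; id)
open import Function.Definitions using (Injective)
open import Relation.Binary.PropositionalEquality
  using (_≡_; refl; sym; trans; cong; cong₂; subst; subst₂; module ≡-Reasoning)
open import Relation.Nullary using (yes; no; ¬?)
open import Relation.Nullary.Decidable using (_×-dec_)

img-∈⁺ : ∀ {a b} (f : Fin a → Fin b) (S : Subset a) {i} → i ∈ S → f i ∈ img f S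
img-∈⁺ f (inside  ∷ S) here      = x∈p∪q⁺ (inj₁ (x∈⁅x⁆ _))
img-∈⁺ f (inside  ∷ S) (there h) = x∈p∪q⁺ (inj₂ (img-∈⁺ (f ∘ F.suc) S h))
img-∈⁺ f (outside ∷ S) (there h) = img-∈⁺ (f ∘ F.suc) S h

img-∈⁻ : ∀ {a b} (f : Fin a → Fin b) (S : Subset a) {x} →
         x ∈ img f S → ∃[ i ] (i ∈ S × f i ≡ x)
img-∈⁻ {zero}  f []            x∈ = ⊥-elim (∉⊥ x∈)
img-∈⁻ {suc a} f (inside ∷ S)  x∈ with x∈p∪q⁻ ⁅ f F.zero ⁆ (img (f ∘ F.suc) S) x∈
... | inj₁ h = F.zero , here , sym (x∈⁅y⁆⇒x≡y _ h)
... | inj₂ h with img-∈⁻ (f ∘ F.suc) S h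
...   | i , i∈ , eq = F.suc i , there i∈ , eq
img-∈⁻ {suc a} f (outside ∷ S) x∈ with img-∈⁻ (f ∘ F.suc) S x∈
... | i , i∈ , eq = F.suc i , there i∈ , eq

img-mono : ∀ {a b} (f : Fin a → Fin b) {P Q : Subset a} → P ⊆ Q → img f P ⊆ img f Q
img-mono f {P} {Q} P⊆Q h with img-∈⁻ f P h
... | i , i∈ , refl = img-∈⁺ f Q (P⊆Q i∈)

img-∪ : ∀ {a b} (f : Fin a → Fin b) (P Q : Subset a) → img f (P ∪ Q) ≡ img f P ∪ img f Q
img-∪ f P Q = ⊆-antisym split merge
  where
  split : img f (P ∪ Q) ⊆ img f P ∪ img f Q
  split h with img-∈⁻ f (P ∪ Q) h
  ... | i , i∈ , refl = x∈p∪q⁺ ([ inj₁ ∘ img-∈⁺ f P , inj₂ ∘ img-∈⁺ f Q ] (x∈p∪q⁻ P Q i∈))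
  merge : img f P ∪ img f Q ⊆ img f (P ∪ Q)
  merge h = [ img-mono f (p⊆p∪q Q) , img-mono f (q⊆p∪q P Q) ] (x∈p∪q⁻ (img f P) (img f Q) h)

img-injective : ∀ {a b} (f : Fin a → Fin b) → Injective _≡_ _≡_ f →
                ∀ P Q → img f P ≡ img f Q → P ≡ Q
img-injective f f-inj P Q eq = ⊆-antisym (pull-back P Q eq) (pull-back Q P (sym eq))
  where
  pull-back : ∀ P Q → img f P ≡ img f Q → P ⊆ Q
  pull-back P Q eq {i} h with img-∈⁻ f Q (subst (f i ∈_) eq (img-∈⁺ f P h))
  ... | j , j∈ , fj≡fi rewrite f-inj fj≡fi = j∈

∣⁅x⁆∪p∣ : ∀ {a} (x : Fin a) (p : Subset a) → x ∉ p → ∣ ⁅ x ⁆ ∪ p ∣ ≡ suc ∣ p ∣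
∣⁅x⁆∪p∣ F.zero    (inside  ∷ p) x∉ = ⊥-elim (x∉ here)
∣⁅x⁆∪p∣ F.zero    (outside ∷ p) x∉ = cong (suc ∘ ∣_∣) (∪-identityˡ p)
∣⁅x⁆∪p∣ (F.suc x) (inside  ∷ p) x∉ = cong suc (∣⁅x⁆∪p∣ x p (x∉ ∘ there))
∣⁅x⁆∪p∣ (F.suc x) (outside ∷ p) x∉ = ∣⁅x⁆∪p∣ x p (x∉ ∘ there)

∣img∣ : ∀ {a b} (f : Fin a → Fin b) → Injective _≡_ _≡_ f → ∀ S → ∣ img f S ∣ ≡ ∣ S ∣
∣img∣ {zero}  {b} f f-inj []           = ∣⊥∣≡0 b
∣img∣ {suc a}     f f-inj (inside ∷ S) = begin
    ∣ ⁅ f F.zero ⁆ ∪ img (f ∘ F.suc) S ∣  ≡⟨ ∣⁅x⁆∪p∣ (f F.zero) _ f0∉ ⟩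
    suc ∣ img (f ∘ F.suc) S ∣            ≡⟨ cong suc (∣img∣ (f ∘ F.suc) (suc-injective ∘ f-inj) S) ⟩
    suc ∣ S ∣                            ∎
  where
  open ≡-Reasoning
  f0∉ : f F.zero ∉ img (f ∘ F.suc) S
  f0∉ h with img-∈⁻ (f ∘ F.suc) S h
  ... | i , _ , fsi≡f0 with f-inj fsi≡f0
  ... | ()
∣img∣ {suc a} f f-inj (outside ∷ S) = ∣img∣ (f ∘ F.suc) (suc-injective ∘ f-inj) S

img-onto : ∀ {a b} (f : Fin a → Fin b) {S : Subset b} → S ⊆ img f ⊤ →
           ∃[ S′ ] img f S′ ≡ S
img-onto f {S} S⊆ = preimage , ⊆-antisym inS onto
  where
  preimage : Subset _
  preimage = tabulate (λ i → lookup S (f i))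
  inS : img f preimage ⊆ S
  inS h with img-∈⁻ f preimage h
  ... | i , i∈ , refl = lookup⇒[]= _ S (trans (sym (lookup∘tabulate _ i)) ([]=⇒lookup i∈))
  onto : S ⊆ img f preimage
  onto h with img-∈⁻ f ⊤ (S⊆ h)
  ... | i , _ , refl = img-∈⁺ f preimage (lookup⇒[]= i _ (trans (lookup∘tabulate _ i) ([]=⇒lookup h)))

⊆-or-outside : ∀ {a} (P Q : Subset a) → P ⊆ Q ⊎ ∃[ x ] (x ∈ P × x ∉ Q)
⊆-or-outside P Q with any? (λ x → x ∈? P ×-dec ¬? (x ∈? Q))
... | yes escape = inj₂ escape
... | no ¬escape = inj₁ contained
  where
  contained : P ⊆ Q
  contained {x} x∈P with x ∈? Q
  ... | yes x∈Q = x∈Q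
  ... | no  x∉Q = ⊥-elim (¬escape (x , x∈P , x∉Q))

p⊆q⇒p∪q≡q : ∀ {a} {P Q : Subset a} → P ⊆ Q → P ∪ Q ≡ Q
p⊆q⇒p∪q≡q {P = P} {Q} P⊆Q = ⊆-antisym (λ h → [ P⊆Q , id ] (x∈p∪q⁻ P Q h)) (q⊆p∪q P Q)

∣p∣<∣p∪q∣ : ∀ {a} {P Q : Subset a} {x} → x ∈ Q → x ∉ P → ∣ P ∣ < ∣ P ∪ Q ∣
∣p∣<∣p∪q∣ {Q = Q} {x} x∈Q x∉P = p⊂q⇒∣p∣<∣q∣ (p⊆p∪q Q , x , x∈p∪q⁺ (inj₂ x∈Q) , x∉P)

∣q∣<∣p∪q∣ : ∀ {a} {P Q : Subset a} {x} → x ∈ P → x ∉ Q → ∣ Q ∣ < ∣ P ∪ Q ∣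
∣q∣<∣p∪q∣ {P = P} {Q} {x} x∈P x∉Q = p⊂q⇒∣p∣<∣q∣ (q⊆p∪q P Q , x , x∈p∪q⁺ (inj₁ x∈P) , x∉Q)

Split : (M : BHyp) → Subset (n M) → Set
Split M T = Σ (Subset (n M)) λ A₁ → Σ (Subset (n M)) λ A₂ →
  E M A₁ × E M A₂ × T ≡ A₁ ∪ A₂ × (∣ A₁ ∣ ⊔ ∣ A₂ ∣) < ∣ T ∣ × B M A₁ A₂

Reducible : (M : BHyp) → Subset (n M) → Set
Reducible M T = 2 < ∣ T ∣ → Split M T

-- TwoReducible M unfolds to  E M ⊤ × EdgesReducible M.
EdgesReducible : BHyp → Set
EdgesReducible M = ∀ T → E M T → Reducible M T

record Embedding (M M′ : BHyp) : Set where
  field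
    map      : Fin (n M) → Fin (n M′)
    map-inj  : Injective _≡_ _≡_ map
    map-edge : ∀ {K} → E M K → E M′ (img map K)
    map-rel  : ∀ {P Q} → B M P Q → B M′ (img map P) (img map Q)

module _ {M M′ : BHyp} (e : Embedding M M′) where
  open Embedding e

  embed-split : ∀ {K} → Split M K → Split M′ (img map K)
  embed-split {K} (A₁ , A₂ , e₁ , e₂ , K≡ , smaller , rel) =
    img map A₁ , img map A₂ , map-edge e₁ , map-edge e₂ ,
    trans (cong (img map) K≡) (img-∪ map A₁ A₂) ,
    subst₂ _<_ (sym (cong₂ _⊔_ (∣img∣ map map-inj A₁) (∣img∣ map map-inj A₂)))
               (sym (∣img∣ map map-inj K)) smaller ,
    map-rel rel

  embed-reducible : ∀ {K} → Reducible M K → Reducible M′ (img map K)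
  embed-reducible {K} red lt = embed-split (red (subst (2 <_) (∣img∣ map map-inj K) lt))

-- A splitting in M of an edge lying in the range of ι is a splitting in the
-- sub-b-hypergraph on that range: its parts are images as well.
sub-split : ∀ (M : BHyp) {m} (ι : Fin m → Fin (n M)) → Injective _≡_ _≡_ ι →
            ∀ K → Split M (img ι K) → Split (sub M ι) K
sub-split M ι ι-inj K (A₁ , A₂ , e₁ , e₂ , K≡ , smaller , rel)
  with img-onto ι (img-mono ι ⊆⊤ ∘ subst (_ ∈_) (sym K≡) ∘ p⊆p∪q A₂)
     | img-onto ι (img-mono ι ⊆⊤ ∘ subst (_ ∈_) (sym K≡) ∘ q⊆p∪q A₁ A₂)
... | A₁′ , refl | A₂′ , refl =
  A₁′ , A₂′ , e₁ , e₂ ,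
  img-injective ι ι-inj K (A₁′ ∪ A₂′) (trans K≡ (sym (img-∪ ι A₁′ A₂′))) ,
  subst₂ _<_ (cong₂ _⊔_ (∣img∣ ι ι-inj A₁′) (∣img∣ ι ι-inj A₂′))
             (∣img∣ ι ι-inj K) smaller ,
  rel

sub-reducible : ∀ (M : BHyp) {m} (ι : Fin m → Fin (n M)) → Injective _≡_ _≡_ ι →
                EdgesReducible M → EdgesReducible (sub M ι)
sub-reducible M ι ι-inj red K eK lt =
  sub-split M ι ι-inj K (red (img ι K) eK (subst (2 <_) (sym (∣img∣ ι ι-inj K)) lt))

module Gluing (M₁ M₂ : BHyp) {k} {φ₁ : Fin k → Fin (n M₁)} {φ₂ : Fin k → Fin (n M₂)}
              (g : GlueData φ₁ φ₂) where
  open GlueData g hiding (n)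

  G : BHyp
  G = glue M₁ M₂ g

  τ₁-embedding : Embedding M₁ G
  τ₁-embedding = record
    { map = τ₁ ; map-inj = τ₁-inj
    ; map-edge = λ {K} eK → inj₁ (K , eK , refl)
    ; map-rel  = λ {P} {Q} b → inj₁ (P , Q , b , refl , refl) }

  τ₂-embedding : Embedding M₂ G
  τ₂-embedding = record
    { map = τ₂ ; map-inj = τ₂-inj
    ; map-edge = λ {K} eK → inj₂ (inj₁ (K , eK , refl))
    ; map-rel  = λ {P} {Q} b → inj₂ (inj₁ (P , Q , b , refl , refl)) }

  τ₁-private : ∀ {a} K → a ∉ img φ₁ ⊤ → τ₁ a ∉ img τ₂ K
  τ₁-private {a} K a∉ h with img-∈⁻ τ₂ K h
  ... | b , _ , τ₂b≡τ₁a with only a b (sym τ₂b≡τ₁a)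
  ...   | x , refl , _ = a∉ (img-∈⁺ φ₁ ⊤ ∈⊤)

  τ₂-private : ∀ {b} K → b ∉ img φ₂ ⊤ → τ₂ b ∉ img τ₁ K
  τ₂-private {b} K b∉ h with img-∈⁻ τ₁ K h
  ... | a , _ , τ₁a≡τ₂b with only a b τ₁a≡τ₂b
  ...   | x , _ , refl = b∉ (img-∈⁺ φ₂ ⊤ ∈⊤)

  τ₁-shared : ∀ {K₁ K₂} → K₁ ⊆ img φ₁ ⊤ → img φ₂ ⊤ ⊆ K₂ → img τ₁ K₁ ⊆ img τ₂ K₂
  τ₁-shared {K₁} {K₂} K₁⊆ ⊆K₂ h with img-∈⁻ τ₁ K₁ h
  ... | a , a∈ , refl with img-∈⁻ φ₁ ⊤ (K₁⊆ a∈)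
  ...   | x , _ , refl = subst (_∈ img τ₂ K₂) (sym (agree x)) (img-∈⁺ τ₂ K₂ (⊆K₂ (img-∈⁺ φ₂ ⊤ ∈⊤)))

  τ₂-shared : ∀ {K₁ K₂} → K₂ ⊆ img φ₂ ⊤ → img φ₁ ⊤ ⊆ K₁ → img τ₂ K₂ ⊆ img τ₁ K₁
  τ₂-shared {K₁} {K₂} K₂⊆ ⊆K₁ h with img-∈⁻ τ₂ K₂ h
  ... | b , b∈ , refl with img-∈⁻ φ₂ ⊤ (K₂⊆ b∈)
  ...   | x , _ , refl = subst (_∈ img τ₁ K₁) (agree x) (img-∈⁺ τ₁ K₁ (⊆K₁ (img-∈⁺ φ₁ ⊤ ∈⊤)))

  glue-⊤ : E M₁ ⊤ → E M₂ ⊤ → E G ⊤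
  glue-⊤ e₁ e₂ = inj₂ (inj₂ (⊤ , ⊤ , e₁ , e₂ , ⊆⊤ , ⊆⊤ , ⊆-antisym covered ⊆⊤))
    where
    covered : ⊤ ⊆ img τ₁ ⊤ ∪ img τ₂ ⊤
    covered {v} _ with cover v
    ... | inj₁ (a , refl) = x∈p∪q⁺ (inj₁ (img-∈⁺ τ₁ ⊤ ∈⊤))
    ... | inj₂ (b , refl) = x∈p∪q⁺ (inj₂ (img-∈⁺ τ₂ ⊤ ∈⊤))

  -- A joint edge is reducible: it collapses onto one half, or the halves
  -- (each missing a private vertex of the other) split it.
  joint-reducible : ∀ {K₁ K₂} → E M₁ K₁ → E M₂ K₂ → Reducible M₁ K₁ → Reducible M₂ K₂ →
                    img φ₁ ⊤ ⊆ K₁ → img φ₂ ⊤ ⊆ K₂ → Reducible G (img τ₁ K₁ ∪ img τ₂ K₂)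
  joint-reducible {K₁} {K₂} e₁ e₂ red₁ red₂ ⊆K₁ ⊆K₂
    with ⊆-or-outside K₁ (img φ₁ ⊤) | ⊆-or-outside K₂ (img φ₂ ⊤)
  ... | inj₁ K₁⊆ | _ = subst (Reducible G) (sym (p⊆q⇒p∪q≡q (τ₁-shared K₁⊆ ⊆K₂)))
                             (embed-reducible τ₂-embedding red₂)
  ... | inj₂ _ | inj₁ K₂⊆ = subst (Reducible G) (sym (trans (∪-comm _ _) (p⊆q⇒p∪q≡q (τ₂-shared K₂⊆ ⊆K₁))))
                                  (embed-reducible τ₁-embedding red₁)
  ... | inj₂ (a , a∈ , a∉) | inj₂ (b , b∈ , b∉) = λ _ →
    img τ₁ K₁ , img τ₂ K₂ , inj₁ (K₁ , e₁ , refl) , inj₂ (inj₁ (K₂ , e₂ , refl)) , refl ,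
    ⊔-lub (∣p∣<∣p∪q∣ (img-∈⁺ τ₂ K₂ b∈) (τ₂-private K₁ b∉))
          (∣q∣<∣p∪q∣ (img-∈⁺ τ₁ K₁ a∈) (τ₁-private K₂ a∉)) ,
    inj₂ (inj₂ (inj₁ (K₁ , K₂ , e₁ , e₂ , ⊆K₁ , ⊆K₂ , refl , refl)))

  glue-reducible : EdgesReducible M₁ → EdgesReducible M₂ → EdgesReducible G
  glue-reducible red₁ red₂ _ (inj₁ (K , eK , refl)) =
    embed-reducible τ₁-embedding (red₁ K eK)
  glue-reducible red₁ red₂ _ (inj₂ (inj₁ (K , eK , refl))) =
    embed-reducible τ₂-embedding (red₂ K eK)
  glue-reducible red₁ red₂ _ (inj₂ (inj₂ (K₁ , K₂ , e₁ , e₂ , ⊆K₁ , ⊆K₂ , refl))) =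
    joint-reducible e₁ e₂ (red₁ K₁ e₁) (red₂ K₂ e₂) ⊆K₁ ⊆K₂

  glue-twoReducible : TwoReducible M₁ → TwoReducible M₂ → TwoReducible G
  glue-twoReducible (top₁ , red₁) (top₂ , red₂) = glue-⊤ top₁ top₂ , glue-reducible red₁ red₂

restriction-twoReducible : ∀ {M L X} → TwoReducible M → E M L → (d : RData M L X) →
                           TwoReducible (sub M (RData.ι d))
restriction-twoReducible {M} (_ , red) eL d =
  subst (E M) (sym ι-img) eL , sub-reducible M ι ι-inj red
  where open RData d

reflect-twoReducible : ∀ {M L X} → TwoReducible M → E M L → (d : RData M L X) →
                       TwoReducible (reflect M d)
reflect-twoReducible {M} M-red eL d =
  Gluing.glue-twoReducible M (sub M (RData.ι d)) (RData.gd d)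
    M-red (restriction-twoReducible M-red eL d)

-- The only edge of the trivial complex has two vertices.
trivial-twoReducible : TwoReducible trivialRC
trivial-twoReducible = refl , λ { _ refl (s≤s (s≤s ())) }

lemma5p3 : (M : BHyp) → ReflectionComplex M → TwoReducible M
lemma5p3 _ triv                     = trivial-twoReducible
lemma5p3 _ (step {M} rc L X eL _ d) = reflect-twoReducible (lemma5p3 M rc) eL d
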